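{- Let $n\ge1$, $k\ge2$. Let $(s_t)$ be the play of the $(n,k)$-shift-game when Alice uses the strategy $A^*$ and Bob uses the strategy $B^*$. Then $(s_t)_{t=0}^{k^n-1}=(w_{k^n-t})_{t=1}^{k^n}$, i.e. $s_t=w_{k^n-1-t}$ for $0\le t\le k^n-1$, where $(w_i)_{i=0}^{k^n-1}$ is the $(k,n)$-prefer-max cycle.
   Context: $[k]=\{0,\dots,k-1\}$; words written by concatenation. Prefer-max cycle: $(w_i)_{i=0}^{k^n-1}$ with $w_0=0^{n-1}(k-1)$ and, if $w_i=\sigma x$ ($\sigma\in[k]$, $x\in[k]^{n-1}$), $w_{i+1}=x\tau$ with $\tau$ the maximal letter such that $x\tau\notin\{w_0,\dots,w_i\}$; known (Martin) to be well defined and to enumerate $[k]^n$ exactly once. Indices are read modulo $k^n$ ($w_{ -1}=w_{k^n-1}$). Strategies: a strategy for Bob is $B\colon[k]^n\to\{0,1\}$ with $B(x(k-1))=0$ for all $x\in[k]^{n-1}$; a strategy for Alice is $A\colon[k]^n\to\{0,1\}$ with $A(x0)=0$ for all $x$. The $(n,k)$-shift-game: a play is $s_0,\dots,s_m$ with $s_0=0^n$ and, if $s_t=x\sigma$, then $s_{t+1}=(\sigma+1)x$ if $B(s_t)=1$; $s_{t+1}=0x$ if $B(s_t)=0$ and $A(s_t)=1$; $s_{t+1}=\sigma x$ otherwise. The play ends at the first $m>0$ with $s_m\in\{s_0,\dots,s_{m-1}\}$. Alice wins if $m<k^n$ and $s_m=0^n$; Bob wins if $s_m\ne0^n$; tie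 if $m=k^n$ and $s_m=0^n$. $B^*(w_i)=1$ iff $w_i=x\sigma$ and $w_{i-1}=(\sigma+1)x$ for some $x\in[k]^{n-1}$, $\sigma<k-1$; else $0$. $A^*(w_i)=1$ iff $w_i=x\sigma$ with $\sigma\ne0$ and ($w_{i-1}=0x$ or $B^*(w_i)=1$); else $0$. -}

module Defs where

open import Data.Nat using (ℕ; zero; suc; _∸_; _^_; _<_; _<?_; s≤s)
open import Data.Fin using (Fin; toℕ; fromℕ; fromℕ<) renaming (zero to fzero; _≟_ to _≟F_)
open import Data.Vec using (Vec; _∷_; []; replicate; _∷ʳ_; init; last; tail)
open import Data.Vec.Properties using (≡-dec)
open import Data.List using (List; []; _∷_; reverse; filter)
open import Data.List.Membership.DecPropositional using (_∈?_)
open import Data.List.Base using (allFin)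
open import Data.Product using (_×_; _,_; proj₁; proj₂)
open import Data.Bool using (Bool; true; false; _∨_; _∧_; not; if_then_else_)
open import Function using (_∘_)
open import Relation.Nullary using (yes; no; ¬?; does)
open import Relation.Binary.PropositionalEquality using (_≡_)
open import Relation.Binary using (DecidableEquality)

-- Conventions: the alphabet [k] with k = suc k' is Fin (suc k');
-- words of length n = suc m are Vec (Fin (suc k')) (suc m).
-- Concatenation "x σ" is  x ∷ʳ σ  ;  "σ x" is  σ ∷ x.

Word : ℕ → ℕ → Set
Word k' m = Vec (Fin (suc k')) (suc m)

module _ (k' m : ℕ) where

  _≟W_ : DecidableEquality (Word k' m)
  _≟W_ = ≡-dec _≟F_

  maxL : Fin (suc k')
  maxL = fromℕ k'

  -- σ+1, for σ < k-1 (left unchanged when σ = k-1; never used then)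
  succL : Fin (suc k') → Fin (suc k')
  succL σ with suc (toℕ σ) <? suc k'
  ... | yes p = fromℕ< p
  ... | no _  = σ

  lettersDesc : List (Fin (suc k'))
  lettersDesc = reverse (allFin (suc k'))

  firstL : {A : Set} → List A → A → A
  firstL []      d = d
  firstL (a ∷ _) d = a

  w₀ : Word k' m
  w₀ = replicate m fzero ∷ʳ maxL

  zeroWord : Word k' m
  zeroWord = replicate (suc m) fzero

  -- prefer-max successor: from w = σx with visited set vs, go to xτ with
  -- τ maximal such that xτ ∉ vs (fallback: w itself, never needed by Martin's theorem)
  preferMaxNext : List (Word k' m) → Word k' m → Word k' m
  preferMaxNext vs w =
    firstL (filter (λ u → ¬? (_∈?_ _≟W_ u vs))
                   (Data.List.map (λ τ → tail w ∷ʳ τ) lettersDesc)) w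
    where import Data.List

  -- (list of visited words w_i, ..., w_0 ; current word w_i)
  preferMaxState : ℕ → List (Word k' m) × Word k' m
  preferMaxState zero = (w₀ ∷ []) , w₀
  preferMaxState (suc i) with preferMaxState i
  ... | vs , c = let c' = preferMaxNext vs c in (c' ∷ vs) , c'

  preferMax : ℕ → Word k' m
  preferMax i = proj₂ (preferMaxState i)

  size : ℕ
  size = suc k' ^ suc m

  -- index of a word in the cycle: least i < k^n with w_i = u (fallback 0)
  indexFrom : ℕ → ℕ → Word k' m → ℕ
  indexFrom i zero      u = zero
  indexFrom i (suc r)   u with preferMax i ≟W u
  ... | yes _ = i
  ... | no _  = indexFrom (suc i) r u

  index : Word k' m → ℕ
  index u = indexFrom zero size u

  predW : Word k' m → Word k' m
  predW u with index u
  ... | zero  = preferMax (size ∸ 1)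
  ... | suc i = preferMax i

  Bstar : Word k' m → Bool
  Bstar u with toℕ (last u) <? k'
  ... | no _  = false
  ... | yes _ = does (predW u ≟W (succL (last u) ∷ init u))

  Astar : Word k' m → Bool
  Astar u = not (does (last u ≟F fzero))
            ∧ (does (predW u ≟W (fzero ∷ init u)) ∨ Bstar u)

  gameStep : (Word k' m → Bool) → (Word k' m → Bool) → Word k' m → Word k' m
  gameStep B A s =
    if B s then succL (last s) ∷ init s
    else (if A s then fzero ∷ init s else last s ∷ init s)

  play : (Word k' m → Bool) → (Word k' m → Bool) → ℕ → Word k' m
  play B A zero    = zeroWord
  play B A (suc t) = gameStep B A (play B A t)

-- Read the prefer-max cycle w₀, w₁, … as a walk in the de Bruijn graph on [k]ⁿ⁻¹, the word u being
-- the edge init u → tail u. The visited edges form a trail from 0ⁿ⁻¹, so every node other than the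
-- two endpoints has as many visited in- as out-edges. Combined with the greedy rule (the out-edges
-- used at a node are those with the largest last letters) this balance shows that the visited words
-- are closed under raising a nonzero letter, and hence that every step τx → xσ of the cycle has
-- τ = σ + 1, τ = 0 or τ = σ. It also shows that the greedy walk can only get stuck at 0ⁿ after having
-- visited all kⁿ words (Martin). Read backwards, the cycle is a play of the shift-game: B* lets Bob
-- undo the steps with τ = σ + 1, A* lets Alice undo those with τ = 0, and the other steps are passes.
module Submission where

open import Defs
open import Data.Nat as ℕ using (ℕ; zero; suc; _∸_; _^_; _<_; _≤_; _+_; z≤n; s≤s)
import Data.Nat.Properties as ℕP
open import Data.Nat.GeneralisedArithmetic using (iterate)
open import Data.Fin as F using (Fin; toℕ; funToFin; finToFun) renaming (zero to fzero; suc to fsuc)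
import Data.Fin.Properties as FP
open import Data.Vec as V using (Vec; []; _∷_; _∷ʳ_; init; last; tail; replicate; lookup; tabulate)
import Data.Vec.Properties as VP
open import Data.List as L using (List; []; _∷_; filter; reverse)
open import Data.List.Membership.Propositional using (_∈_; _∉_)
import Data.List.Membership.Propositional.Properties as MP
import Data.List.Membership.DecPropositional as DecMembership
open import Data.List.Relation.Unary.Any using (here; there)
import Data.List.Relation.Unary.Any.Properties as AnyP
open import Data.List.Relation.Unary.All as All using (All; []; _∷_)
open import Data.List.Relation.Unary.AllPairs using (AllPairs; []; _∷_)
import Data.List.Relation.Unary.AllPairs.Properties as AllPairsP
import Data.List.Properties as LP
open import Data.Product using (∃; _×_; _,_; proj₁; proj₂)
open import Data.Sum using (_⊎_; inj₁; inj₂; [_,_]′; map₂)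
open import Data.Empty using (⊥-elim)
open import Data.Bool using (Bool; true; false)
open import Function using (_∘_; flip)
open import Function.Definitions using (Injective)
open import Level using (Level)
open import Relation.Nullary using (Dec; yes; no; ¬_; ¬?; contradiction)
open import Relation.Nullary.Decidable using (decidable-stable; dec-true; dec-false)
open import Relation.Unary using (Pred; Decidable)
open import Relation.Binary.Definitions using (DecidableEquality; tri<; tri≈; tri>)
open import Relation.Binary.PropositionalEquality

private
  variable
    p q : Level
    A : Set
    n : ℕ

-- Counting over Fin n

⟦_⟧ : {X : Set p} → Dec X → ℕ
⟦ yes _ ⟧ = 1
⟦ no _ ⟧ = 0

⟦⟧-yes : {X : Set p} (d : Dec X) → X → ⟦ d ⟧ ≡ 1
⟦⟧-yes (yes _) _ = refl
⟦⟧-yes (no ¬x) x = contradiction x ¬x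

⟦⟧-no : {X : Set p} (d : Dec X) → ¬ X → ⟦ d ⟧ ≡ 0
⟦⟧-no (yes x) ¬x = contradiction x ¬x
⟦⟧-no (no _) _ = refl

⟦⟧-cong : {X : Set p} {Y : Set q} (d : Dec X) (e : Dec Y) → (X → Y) → (Y → X) → ⟦ d ⟧ ≡ ⟦ e ⟧
⟦⟧-cong (yes _) (yes _) _ _ = refl
⟦⟧-cong (yes x) (no ¬y) f _ = contradiction (f x) ¬y
⟦⟧-cong (no ¬x) (yes y) _ g = contradiction (g y) ¬x
⟦⟧-cong (no _) (no _) _ _ = refl

count : {P : Pred (Fin n) p} → Decidable P → ℕ
count {zero} _ = 0
count {suc n} P? = ⟦ P? fzero ⟧ + count (P? ∘ fsuc)

count-mono : {P : Pred (Fin n) p} {Q : Pred (Fin n) q} (P? : Decidable P) (Q? : Decidable Q) →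
             (∀ a → P a → Q a) → count P? ≤ count Q?
count-mono {n = zero} _ _ _ = z≤n
count-mono {n = suc n} P? Q? P⊆Q with P? fzero | Q? fzero
... | yes _ | yes _ = s≤s (count-mono (P? ∘ fsuc) (Q? ∘ fsuc) (P⊆Q ∘ fsuc))
... | yes p₀ | no ¬q₀ = contradiction (P⊆Q fzero p₀) ¬q₀
... | no _ | yes _ = ℕP.m≤n⇒m≤1+n (count-mono (P? ∘ fsuc) (Q? ∘ fsuc) (P⊆Q ∘ fsuc))
... | no _ | no _ = count-mono (P? ∘ fsuc) (Q? ∘ fsuc) (P⊆Q ∘ fsuc)

count-cong : {P : Pred (Fin n) p} {Q : Pred (Fin n) q} (P? : Decidable P) (Q? : Decidable Q) →
             (∀ a → P a → Q a) → (∀ a → Q a → P a) → count P? ≡ count Q?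
count-cong P? Q? P⊆Q Q⊆P = ℕP.≤-antisym (count-mono P? Q? P⊆Q) (count-mono Q? P? Q⊆P)

count-insert : {P : Pred (Fin n) p} {Q : Pred (Fin n) q} (P? : Decidable P) (Q? : Decidable Q) (a : Fin n) →
               ¬ P a → Q a → (∀ b → Q b → P b ⊎ b ≡ a) → (∀ b → P b → Q b) →
               count Q? ≡ suc (count P?)
count-insert {n = suc n} P? Q? fzero ¬Pa Qa Q⊆P+a P⊆Q with P? fzero | Q? fzero
... | yes p₀ | _ = contradiction p₀ ¬Pa
... | no _ | no ¬q₀ = contradiction Qa ¬q₀
... | no _ | yes _ = cong suc (count-cong (Q? ∘ fsuc) (P? ∘ fsuc)
       (λ b qb → [ (λ pb → pb) , (λ ()) ]′ (Q⊆P+a (fsuc b) qb)) (P⊆Q ∘ fsuc))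
count-insert {n = suc n} P? Q? (fsuc a) ¬Pa Qa Q⊆P+a P⊆Q with P? fzero | Q? fzero
... | yes p₀ | no ¬q₀ = contradiction (P⊆Q fzero p₀) ¬q₀
... | no ¬p₀ | yes q₀ = ⊥-elim ([ ¬p₀ , (λ ()) ]′ (Q⊆P+a fzero q₀))
... | yes _ | yes _ = cong suc (count-insert (P? ∘ fsuc) (Q? ∘ fsuc) a ¬Pa Qa
       (λ b qb → map₂ FP.suc-injective (Q⊆P+a (fsuc b) qb)) (P⊆Q ∘ fsuc))
... | no _ | no _ = count-insert (P? ∘ fsuc) (Q? ∘ fsuc) a ¬Pa Qa
       (λ b qb → map₂ FP.suc-injective (Q⊆P+a (fsuc b) qb)) (P⊆Q ∘ fsuc)

count≤n : {P : Pred (Fin n) p} (P? : Decidable P) → count P? ≤ n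
count≤n {n = zero} _ = z≤n
count≤n {n = suc n} P? with P? fzero
... | yes _ = s≤s (count≤n (P? ∘ fsuc))
... | no _ = ℕP.m≤n⇒m≤1+n (count≤n (P? ∘ fsuc))

count≡n : {P : Pred (Fin n) p} (P? : Decidable P) → (∀ a → P a) → count P? ≡ n
count≡n {n = zero} _ _ = refl
count≡n {n = suc n} P? all with P? fzero
... | yes _ = cong suc (count≡n (P? ∘ fsuc) (all ∘ fsuc))
... | no ¬p₀ = contradiction (all fzero) ¬p₀

count≡0 : {P : Pred (Fin n) p} (P? : Decidable P) → (∀ a → ¬ P a) → count P? ≡ 0
count≡0 {n = zero} _ _ = refl
count≡0 {n = suc n} P? none with P? fzero
... | yes p₀ = contradiction p₀ (none fzero)
... | no _ = count≡0 (P? ∘ fsuc) (none ∘ fsuc)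

count≡n⇒all : {P : Pred (Fin n) p} (P? : Decidable P) → count P? ≡ n → ∀ a → P a
count≡n⇒all {n = suc n} P? eq a with P? fzero
count≡n⇒all {n = suc n} P? eq fzero | yes p₀ = p₀
count≡n⇒all {n = suc n} P? eq (fsuc a) | yes _ = count≡n⇒all (P? ∘ fsuc) (ℕP.suc-injective eq) a
count≡n⇒all {n = suc n} P? eq a | no _ =
  contradiction (count≤n (P? ∘ fsuc)) (ℕP.<⇒≱ (ℕP.≤-reflexive (sym eq)))

count-≥ : ∀ n c → count {n} (λ a → c ℕ.≤? toℕ a) ≡ n ∸ c
count-≥ zero zero = refl
count-≥ zero (suc c) = refl
count-≥ (suc n) zero = count≡n (λ a → zero ℕ.≤? toℕ a) (λ _ → z≤n)
count-≥ (suc n) (suc c) = trans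
  (count-cong (λ a → suc c ℕ.≤? suc (toℕ a)) (λ (a : Fin n) → c ℕ.≤? toℕ a)
    (λ _ → ℕP.≤-pred) (λ _ → s≤s))
  (count-≥ n c)

module _ (_≟_ : DecidableEquality A) where
  open DecMembership _≟_ using (_∈?_)

  count-∈-[] : (f : Fin n → A) → count (λ a → f a ∈? []) ≡ 0
  count-∈-[] f = count≡0 (λ a → f a ∈? []) (λ _ ())

  count-∈-∷-hit : (f : Fin n → A) → Injective _≡_ _≡_ f → ∀ {v} xs a → f a ≡ v → v ∉ xs →
                  count (λ b → f b ∈? (v ∷ xs)) ≡ suc (count (λ b → f b ∈? xs))
  count-∈-∷-hit f f-inj xs a refl v∉xs =
    count-insert (λ b → f b ∈? xs) (λ b → f b ∈? (f a ∷ xs)) a v∉xs (here refl)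
      (λ { b (here e) → inj₂ (f-inj e) ; b (there b∈) → inj₁ b∈ }) (λ _ → there)

  count-∈-∷-miss : (f : Fin n → A) → ∀ v xs → (∀ a → f a ≢ v) →
                   count (λ b → f b ∈? (v ∷ xs)) ≡ count (λ b → f b ∈? xs)
  count-∈-∷-miss f v xs miss = count-cong (λ b → f b ∈? (v ∷ xs)) (λ b → f b ∈? xs)
    (λ { b (here e) → contradiction e (miss b) ; b (there b∈) → b∈ }) (λ _ → there)

[n∸a]+1≡[n∸b]+1⇒a≡b : ∀ {n a b} → a ≤ n → b ≤ n → (n ∸ a) + 1 ≡ (n ∸ b) + 1 → a ≡ b
[n∸a]+1≡[n∸b]+1⇒a≡b a≤n b≤n e = ℕP.∸-cancelˡ-≡ a≤n b≤n (ℕP.+-cancelʳ-≡ 1 _ _ e)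

[n∸a]+1≡n∸b⇒a≡1+b : ∀ {n a b} → a ≤ n → b < n → (n ∸ a) + 1 ≡ n ∸ b → a ≡ suc b
[n∸a]+1≡n∸b⇒a≡1+b {n} {a} {b} a≤n b<n e = ℕP.∸-cancelˡ-≡ a≤n b<n (ℕP.suc-injective (begin
  suc (n ∸ a)      ≡⟨ ℕP.+-comm 1 (n ∸ a) ⟩
  (n ∸ a) + 1      ≡⟨ e ⟩
  n ∸ b            ≡⟨ ℕP.+-∸-assoc 1 b<n ⟩
  suc (n ∸ suc b)  ∎))
  where open ≡-Reasoning

module _ {P : ℕ → Set p} (P? : ∀ t → Dec (P t)) where

  all-below-or-first-failure : ∀ t → (∀ s → s < t → P s)
                                   ⊎ ∃ λ s → s < t × (∀ r → r < s → P r) × ¬ P s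
  all-below-or-first-failure zero = inj₁ (λ _ ())
  all-below-or-first-failure (suc t) with all-below-or-first-failure t
  ... | inj₂ (s , s<t , below , ¬Ps) = inj₂ (s , ℕP.m≤n⇒m≤1+n s<t , below , ¬Ps)
  ... | inj₁ below with P? t
  ...   | no ¬Pt = inj₂ (t , ℕP.≤-refl , below , ¬Pt)
  ...   | yes Pt = inj₁ λ s s<1+t →
          [ below s , (λ { refl → Pt }) ]′ (ℕP.m≤n⇒m<n∨m≡n (ℕP.≤-pred s<1+t))

allPairs-reverse : {R : A → A → Set p} {xs : List A} → AllPairs R xs → AllPairs (flip R) (reverse xs)
allPairs-reverse [] = []
allPairs-reverse {R = R} {x ∷ xs} (Rx ∷ Rxs) rewrite LP.unfold-reverse x xs =
  AllPairsP.++⁺ (allPairs-reverse Rxs) ([] ∷ [])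
    (All.tabulate (λ y∈ → All.lookup Rx (AnyP.reverse⁻ y∈) ∷ []))

module _ (k' m : ℕ) {P : Pred A p} (P? : Decidable P) (f : Fin n → A) where

  firstL-filter-greatest : ∀ {a} (xs : List (Fin n)) (d : A) → AllPairs F._>_ xs → a ∈ xs → P (f a) →
    ∃ λ b → firstL k' m (filter P? (L.map f xs)) d ≡ f b × P (f b)
          × (∀ c → c ∈ xs → b F.< c → ¬ P (f c))
  firstL-filter-greatest (c ∷ xs) d (c>xs ∷ sorted) a∈ Pfa with P? (f c)
  ... | yes Pfc = c , refl , Pfc , greatest
    where
    greatest : ∀ c′ → c′ ∈ c ∷ xs → c F.< c′ → ¬ P (f c′)
    greatest c′ (here refl) c<c = contradiction c<c (FP.<-irrefl refl)
    greatest c′ (there c′∈) c<c′ = contradiction (All.lookup c>xs c′∈) (FP.<-asym c<c′)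
  ... | no ¬Pfc with a∈
  ...   | here refl = contradiction Pfa ¬Pfc
  ...   | there a∈xs with firstL-filter-greatest xs d sorted a∈xs Pfa
  ...     | b , first≡ , Pfb , greatest = b , first≡ , Pfb , greatest′
    where
    greatest′ : ∀ c′ → c′ ∈ c ∷ xs → b F.< c′ → ¬ P (f c′)
    greatest′ c′ (here refl) _ = ¬Pfc
    greatest′ c′ (there c′∈) b<c′ = greatest c′ c′∈ b<c′

module _ {K : ℕ} where

  encode : Vec (Fin K) n → Fin (K ^ n)
  encode u = funToFin (lookup u)

  decode : Fin (K ^ n) → Vec (Fin K) n
  decode i = tabulate (finToFun i)

  funToFin-cong : {f g : Fin n → Fin K} → (∀ i → f i ≡ g i) → funToFin f ≡ funToFin g
  funToFin-cong {zero} _ = refl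
  funToFin-cong {suc n} f≗g = cong₂ F.combine (f≗g fzero) (funToFin-cong (f≗g ∘ fsuc))

  decode-encode : (u : Vec (Fin K) n) → decode (encode u) ≡ u
  decode-encode u = trans (VP.tabulate-cong (FP.finToFun-funToFin (lookup u))) (VP.tabulate∘lookup u)

  encode-decode : (i : Fin (K ^ n)) → encode (decode {n} i) ≡ i
  encode-decode {n} i =
    trans (funToFin-cong {n} (VP.lookup∘tabulate (finToFun i))) (FP.funToFin-finToFin {n} {K} i)

  injection-into-words : ∀ {t} (f : Fin t → Vec (Fin K) n) → Injective _≡_ _≡_ f → t ≤ K ^ n
  injection-into-words f f-inj = FP.injective⇒≤ {f = encode ∘ f}
    (λ e → f-inj (trans (sym (decode-encode _)) (trans (cong decode e) (decode-encode _))))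

  surjection-onto-words : ∀ {n t} (f : Fin t → Vec (Fin K) n) → (∀ u → ∃ λ i → f i ≡ u) →
                          K ^ n ≤ t
  surjection-onto-words {n} {t} f f-surj = FP.injective⇒≤ {f = section} section-injective
    where
    section : Fin (K ^ n) → Fin t
    section i = proj₁ (f-surj (decode {n} i))
    section-injective : Injective _≡_ _≡_ section
    section-injective {i} {i′} e = begin
      i                        ≡⟨ encode-decode {n} i ⟨
      encode (decode {n} i)    ≡⟨ cong encode (proj₂ (f-surj (decode i))) ⟨
      encode (f (section i))   ≡⟨ cong (encode ∘ f) e ⟩
      encode (f (section i′))  ≡⟨ cong encode (proj₂ (f-surj (decode i′))) ⟩
      encode (decode {n} i′)   ≡⟨ encode-decode {n} i′ ⟩
      i′                       ∎
      where open ≡-Reasoning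

head-∷-tail : (v : Vec A (suc n)) → V.head v ∷ tail v ≡ v
head-∷-tail (a ∷ v) = refl

init-∷ʳ-last : (v : Vec A (suc n)) → init v ∷ʳ last v ≡ v
init-∷ʳ-last v = sym (proj₂ (proj₂ (V.initLast v)))

replicate-∷ʳ : ∀ n (a : A) → replicate (suc n) a ≡ replicate n a ∷ʳ a
replicate-∷ʳ zero a = refl
replicate-∷ʳ (suc n) a = cong (a ∷_) (replicate-∷ʳ n a)

shiftIn : A → Vec A (suc n) → Vec A (suc n)
shiftIn a u = tail u ∷ʳ a

iterate-shiftIn-∷ʳ : ∀ (a : A) d (v : Vec A (suc n)) →
                     iterate (shiftIn a) (v ∷ʳ a) d ≡ iterate (shiftIn a) v d ∷ʳ a
iterate-shiftIn-∷ʳ a zero v = refl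
iterate-shiftIn-∷ʳ a (suc d) (c ∷ v) = iterate-shiftIn-∷ʳ a d (shiftIn a (c ∷ v))

iterate-shiftIn-replicate : ∀ n (a : A) (u : Vec A (suc n)) →
                            iterate (shiftIn a) u (suc n) ≡ replicate (suc n) a
iterate-shiftIn-replicate zero a (b ∷ []) = refl
iterate-shiftIn-replicate (suc n) a (b ∷ u) = begin
  iterate (shiftIn a) (u ∷ʳ a) (suc n)  ≡⟨ iterate-shiftIn-∷ʳ a (suc n) u ⟩
  iterate (shiftIn a) u (suc n) ∷ʳ a    ≡⟨ cong (_∷ʳ a) (iterate-shiftIn-replicate n a u) ⟩
  replicate (suc n) a ∷ʳ a              ≡⟨ replicate-∷ʳ (suc n) a ⟨
  replicate (suc (suc n)) a             ∎
  where open ≡-Reasoning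

data Raise {K : ℕ} : Vec (Fin K) n → Vec (Fin K) n → Set where
  here  : ∀ {ρ ρ′} {x : Vec (Fin K) n} → 0 < toℕ ρ → ρ F.< ρ′ → Raise (ρ ∷ x) (ρ′ ∷ x)
  there : ∀ {b} {x x′ : Vec (Fin K) n} → Raise x x′ → Raise (b ∷ x) (b ∷ x′)

module _ {K : ℕ} where

  Raise-irrefl : {u u′ : Vec (Fin K) n} → Raise u u′ → u ≢ u′
  Raise-irrefl (here _ ρ<ρ′) e = FP.<-irrefl (VP.∷-injectiveˡ e) ρ<ρ′
  Raise-irrefl (there r) e = Raise-irrefl r (VP.∷-injectiveʳ e)

  Raise-sourceNonzero : {u u′ : Vec (Fin (suc K)) n} → Raise u u′ → u ≢ replicate n fzero
  Raise-sourceNonzero (here 0<ρ _) e with VP.∷-injectiveˡ e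
  ... | refl = contradiction 0<ρ (λ ())
  Raise-sourceNonzero (there r) e = Raise-sourceNonzero r (VP.∷-injectiveʳ e)

  Raise-targetNonzero : {u u′ : Vec (Fin (suc K)) n} → Raise u u′ → u′ ≢ replicate n fzero
  Raise-targetNonzero (here _ ρ<ρ′) e with VP.∷-injectiveˡ e
  ... | refl = contradiction ρ<ρ′ (λ ())
  Raise-targetNonzero (there r) e = Raise-targetNonzero r (VP.∷-injectiveʳ e)

  Raise-∷ʳ : ∀ (y : Vec (Fin K) n) a {u′} → Raise (y ∷ʳ a) u′ →
             (∃ λ y′ → Raise y y′ × u′ ≡ y′ ∷ʳ a)
           ⊎ (∃ λ a′ → a F.< a′ × u′ ≡ y ∷ʳ a′)
  Raise-∷ʳ [] a (here _ a<a′) = inj₂ (_ , a<a′ , refl)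
  Raise-∷ʳ (c ∷ y) a (here 0<c c<c′) = inj₁ (_ , here 0<c c<c′ , refl)
  Raise-∷ʳ (c ∷ y) a (there r) with Raise-∷ʳ y a r
  ... | inj₁ (y′ , r′ , refl) = inj₁ (c ∷ y′ , there r′ , refl)
  ... | inj₂ (a′ , a<a′ , refl) = inj₂ (a′ , a<a′ , refl)

-- Reversing moves with B* and A*

-- LegalMove σ τ: in the shift-game a position xσ may be followed by τx.
data LegalMove {K : ℕ} (σ : Fin (suc K)) : Fin (suc K) → Set where
  up    : ∀ {τ} → toℕ τ ≡ suc (toℕ σ) → LegalMove σ τ
  reset : LegalMove σ fzero
  stay  : LegalMove σ σ

module Strategies (k' m : ℕ) where

  private
    W = Word k' m
    B* = Bstar k' m
    A* = Astar k' m
    predecessor = predW k' m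

  module _ (B A : W → Bool) {u : W} where

    gameStep-bob : B u ≡ true → gameStep k' m B A u ≡ succL k' m (last u) ∷ init u
    gameStep-bob B≡true rewrite B≡true = refl

    gameStep-alice : B u ≡ false → A u ≡ true → gameStep k' m B A u ≡ fzero ∷ init u
    gameStep-alice B≡false A≡true rewrite B≡false | A≡true = refl

    gameStep-pass : B u ≡ false → A u ≡ false → gameStep k' m B A u ≡ last u ∷ init u
    gameStep-pass B≡false A≡false rewrite B≡false | A≡false = refl

  succL-toℕ : (σ : Fin (suc k')) → toℕ σ < k' → toℕ (succL k' m σ) ≡ suc (toℕ σ)
  succL-toℕ σ σ<k' with suc (toℕ σ) ℕ.<? suc k'
  ... | yes σ<1+k' = FP.toℕ-fromℕ< σ<1+k'
  ... | no σ≮1+k' = contradiction (s≤s σ<k') σ≮1+k'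

  Bstar-true : ∀ u → toℕ (last u) < k' → predecessor u ≡ succL k' m (last u) ∷ init u → B* u ≡ true
  Bstar-true u σ<k' pred≡ with toℕ (last u) ℕ.<? k'
  ... | yes _ = dec-true (_≟W_ k' m (predecessor u) _) pred≡
  ... | no σ≮k' = contradiction σ<k' σ≮k'

  Bstar-false : ∀ u {τ} → predecessor u ≡ τ ∷ init u → toℕ τ ≢ suc (toℕ (last u)) → B* u ≡ false
  Bstar-false u pred≡ τ≢ with toℕ (last u) ℕ.<? k'
  ... | no _ = refl
  ... | yes σ<k' = dec-false (_≟W_ k' m (predecessor u) _) λ e →
        τ≢ (trans (cong toℕ (VP.∷-injectiveˡ (trans (sym pred≡) e))) (succL-toℕ (last u) σ<k'))

  Astar-lastZero : ∀ u → last u ≡ fzero → A* u ≡ false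
  Astar-lastZero u σ≡0 rewrite dec-true (last u FP.≟ fzero) σ≡0 = refl

  Astar-reset : ∀ u → last u ≢ fzero → predecessor u ≡ fzero ∷ init u → A* u ≡ true
  Astar-reset u σ≢0 pred≡
    rewrite dec-false (last u FP.≟ fzero) σ≢0
          | dec-true (_≟W_ k' m (predecessor u) (fzero ∷ init u)) pred≡ = refl

  Astar-stay : ∀ u → last u ≢ fzero → predecessor u ≢ fzero ∷ init u → B* u ≡ false → A* u ≡ false
  Astar-stay u σ≢0 pred≢ B≡false
    rewrite dec-false (last u FP.≟ fzero) σ≢0
          | dec-false (_≟W_ k' m (predecessor u) (fzero ∷ init u)) pred≢
          | B≡false = refl

  gameStep-reverses : ∀ u {τ} → predecessor u ≡ τ ∷ init u → LegalMove (last u) τ →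
                      gameStep k' m B* A* u ≡ τ ∷ init u
  gameStep-reverses u {τ} pred≡ (up τ≡1+σ) =
    trans (gameStep-bob B* A* (Bstar-true u σ<k' (trans pred≡ (cong (_∷ init u) (sym succσ≡τ)))))
          (cong (_∷ init u) succσ≡τ)
    where
    σ<k' : toℕ (last u) < k'
    σ<k' = ℕP.≤-pred (subst (_< suc k') τ≡1+σ (FP.toℕ<n τ))
    succσ≡τ : succL k' m (last u) ≡ τ
    succσ≡τ = FP.toℕ-injective (trans (succL-toℕ (last u) σ<k') (sym τ≡1+σ))
  gameStep-reverses u pred≡ reset = aliceResets (last u FP.≟ fzero)
    where
    B≡false = Bstar-false u pred≡ (λ ())
    aliceResets : Dec (last u ≡ fzero) → gameStep k' m B* A* u ≡ fzero ∷ init u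
    aliceResets (yes σ≡0) =
      trans (gameStep-pass B* A* B≡false (Astar-lastZero u σ≡0)) (cong (_∷ init u) σ≡0)
    aliceResets (no σ≢0) = gameStep-alice B* A* B≡false (Astar-reset u σ≢0 pred≡)
  gameStep-reverses u pred≡ stay = gameStep-pass B* A* B≡false (alicePasses (last u FP.≟ fzero))
    where
    B≡false = Bstar-false u pred≡ (ℕP.<⇒≢ (ℕP.n<1+n _))
    alicePasses : Dec (last u ≡ fzero) → A* u ≡ false
    alicePasses (yes σ≡0) = Astar-lastZero u σ≡0
    alicePasses (no σ≢0) = Astar-stay u σ≢0 (σ≢0 ∘ VP.∷-injectiveˡ ∘ trans (sym pred≡)) B≡false

-- The prefer-max walk

module PreferMaxCycle (j m : ℕ) where

  private
    k' = suc j
    K = suc k'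
    Letter = Fin K
    Node = Vec Letter m
    W = Word k' m
    N = size k' m
    0ᵐ : Node
    0ᵐ = replicate m fzero
    0ⁿ : W
    0ⁿ = zeroWord k' m
    move = gameStep k' m (Bstar k' m) (Astar k' m)
    position = play k' m (Bstar k' m) (Astar k' m)

    _≟ₙ_ : DecidableEquality Node
    _≟ₙ_ = VP.≡-dec FP._≟_

    variable
      s s′ t : ℕ
      τ : Letter

  open DecMembership (_≟W_ k' m) using (_∈?_)

  w : ℕ → W
  w = preferMax k' m

  visited : ℕ → List W
  visited t = proj₁ (preferMaxState k' m t)

  visited⁺ : s ≤ t → w s ∈ visited t
  visited⁺ {t = zero} z≤n = here refl
  visited⁺ {s} {suc t} s≤1+t with s ℕP.≟ suc t
  ... | yes refl = here refl
  ... | no s≢1+t = there (visited⁺ (ℕP.≤-pred (ℕP.≤∧≢⇒< s≤1+t s≢1+t)))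

  visited⁻ : ∀ {u} → u ∈ visited t → ∃ λ s → s ≤ t × w s ≡ u
  visited⁻ {zero} (here refl) = 0 , z≤n , refl
  visited⁻ {suc t} (here refl) = suc t , ℕP.≤-refl , refl
  visited⁻ {suc t} (there u∈) with visited⁻ u∈
  ... | s , s≤t , refl = s , ℕP.m≤n⇒m≤1+n s≤t , refl

  Fresh : ℕ → Set
  Fresh t = ∃ λ τ → tail (w t) ∷ʳ τ ∉ visited t

  fresh? : ∀ t → Dec (Fresh t)
  fresh? t = FP.any? (λ τ → ¬? ((tail (w t) ∷ʳ τ) ∈? visited t))

  -- Run t: preferMaxNext has not fallen back to its default value before step t.
  Run : ℕ → Set
  Run t = ∀ s → s < t → Fresh s

  Run-≤ : s ≤ t → Run t → Run s
  Run-≤ s≤t run r r<s = run r (ℕP.<-≤-trans r<s s≤t)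

  record GreedyStep (t : ℕ) : Set where
    field
      letter  : Letter
      next≡   : w (suc t) ≡ tail (w t) ∷ʳ letter
      next∉   : w (suc t) ∉ visited t
      larger∈ : letter F.< τ → tail (w t) ∷ʳ τ ∈ visited t

  lettersDesc-sorted : AllPairs F._>_ (lettersDesc k' m)
  lettersDesc-sorted = allPairs-reverse (AllPairsP.tabulate⁺-< (λ i<j → i<j))

  ∈-lettersDesc : ∀ τ → τ ∈ lettersDesc k' m
  ∈-lettersDesc τ = AnyP.reverse⁺ (MP.∈-allFin τ)

  greedy : ∀ t → Fresh t → GreedyStep t
  greedy t (τ , τ-fresh)
    with firstL-filter-greatest k' m (λ u → ¬? (u ∈? visited t)) (tail (w t) ∷ʳ_)
           (lettersDesc k' m) (w t) lettersDesc-sorted (∈-lettersDesc τ) τ-fresh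
  ... | σ , next≡ , σ-fresh , greatest = record
    { letter  = σ
    ; next≡   = next≡
    ; next∉   = subst (_∉ visited t) (sym next≡) σ-fresh
    ; larger∈ = λ {τ} σ<τ → decidable-stable (_ ∈? visited t) (greatest τ (∈-lettersDesc τ) σ<τ)
    }

  next∉visited : Run (suc t) → w (suc t) ∉ visited t
  next∉visited {t} run = GreedyStep.next∉ (greedy t (run t ℕP.≤-refl))

  init-next : ∀ t → Fresh t → init (w (suc t)) ≡ tail (w t)
  init-next t fresh = trans (cong init next≡) (VP.init-∷ʳ letter _)
    where open GreedyStep (greedy t fresh)

  w-injective : ∀ t → Run t → s < s′ → s′ ≤ t → w s ≢ w s′
  w-injective {s′ = suc s″} t run (s≤s s≤s″) s′≤t ws≡ws′ =
    next∉visited (Run-≤ s′≤t run) (subst (_∈ visited s″) ws≡ws′ (visited⁺ s≤s″))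

  outdeg : List W → Node → ℕ
  outdeg vs x = count (λ σ → (x ∷ʳ σ) ∈? vs)

  indeg : List W → Node → ℕ
  indeg vs x = count (λ b → (b ∷ x) ∈? vs)

  outdeg-∷ : ∀ v vs → v ∉ vs → ∀ x → outdeg (v ∷ vs) x ≡ ⟦ init v ≟ₙ x ⟧ + outdeg vs x
  outdeg-∷ v vs v∉ x with init v ≟ₙ x
  ... | yes refl =
    count-∈-∷-hit (_≟W_ k' m) (init v ∷ʳ_) (VP.∷ʳ-injectiveʳ _ _) vs (last v) (init-∷ʳ-last v) v∉
  ... | no init≢x = count-∈-∷-miss (_≟W_ k' m) (x ∷ʳ_) v vs
                      λ σ e → init≢x (trans (cong init (sym e)) (VP.init-∷ʳ σ x))

  indeg-∷ : ∀ v vs → v ∉ vs → ∀ x → indeg (v ∷ vs) x ≡ ⟦ tail v ≟ₙ x ⟧ + indeg vs x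
  indeg-∷ v vs v∉ x with tail v ≟ₙ x
  ... | yes refl =
    count-∈-∷-hit (_≟W_ k' m) (_∷ tail v) VP.∷-injectiveˡ vs (V.head v) (head-∷-tail v) v∉
  ... | no tail≢x = count-∈-∷-miss (_≟W_ k' m) (_∷ x) v vs λ b e → tail≢x (cong tail (sym e))

  outdeg-[_] : ∀ v x → outdeg (v ∷ []) x ≡ ⟦ init v ≟ₙ x ⟧
  outdeg-[ v ] x = trans (outdeg-∷ v [] (λ ()) x)
    (trans (cong (⟦ init v ≟ₙ x ⟧ +_) (count-∈-[] (_≟W_ k' m) (x ∷ʳ_))) (ℕP.+-identityʳ _))

  indeg-[_] : ∀ v x → indeg (v ∷ []) x ≡ ⟦ tail v ≟ₙ x ⟧
  indeg-[ v ] x = trans (indeg-∷ v [] (λ ()) x)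
    (trans (cong (⟦ tail v ≟ₙ x ⟧ +_) (count-∈-[] (_≟W_ k' m) (_∷ x))) (ℕP.+-identityʳ _))

  -- The visited words form a trail from 0ᵐ to tail (w t) in the de Bruijn graph, u : init u → tail u.
  balance : ∀ t → Run t → ∀ x →
            outdeg (visited t) x + ⟦ tail (w t) ≟ₙ x ⟧ ≡ indeg (visited t) x + ⟦ x ≟ₙ 0ᵐ ⟧
  balance zero _ x = begin
    outdeg (w 0 ∷ []) x + end  ≡⟨ cong (_+ end) (outdeg-[ w 0 ] x) ⟩
    ⟦ init (w 0) ≟ₙ x ⟧ + end  ≡⟨ ℕP.+-comm ⟦ init (w 0) ≟ₙ x ⟧ end ⟩
    end + ⟦ init (w 0) ≟ₙ x ⟧  ≡⟨ cong₂ _+_ (sym (indeg-[ w 0 ] x)) start≡ ⟩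
    indeg (w 0 ∷ []) x + ⟦ x ≟ₙ 0ᵐ ⟧  ∎
    where
    open ≡-Reasoning
    end = ⟦ tail (w 0) ≟ₙ x ⟧
    init-w₀ : init (w 0) ≡ 0ᵐ
    init-w₀ = VP.init-∷ʳ (maxL k' m) 0ᵐ
    start≡ : ⟦ init (w 0) ≟ₙ x ⟧ ≡ ⟦ x ≟ₙ 0ᵐ ⟧
    start≡ = ⟦⟧-cong _ _ (λ e → trans (sym e) init-w₀) (λ e → trans init-w₀ (sym e))
  balance (suc t) run x = begin
    outdeg (v ∷ visited t) x + new-end     ≡⟨ cong (_+ new-end) (outdeg-∷ v (visited t) v∉ x) ⟩
    (⟦ init v ≟ₙ x ⟧ + out) + new-end      ≡⟨ cong (λ y → (⟦ y ≟ₙ x ⟧ + out) + new-end) init≡ ⟩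
    (end + out) + new-end                  ≡⟨ ℕP.+-comm (end + out) new-end ⟩
    new-end + (end + out)                  ≡⟨ cong (new-end +_) (ℕP.+-comm end out) ⟩
    new-end + (out + end)                  ≡⟨ cong (new-end +_) (balance t run′ x) ⟩
    new-end + (inn + start)                ≡⟨ ℕP.+-assoc new-end inn start ⟨
    (new-end + inn) + start                ≡⟨ cong (_+ start) (indeg-∷ v (visited t) v∉ x) ⟨
    indeg (v ∷ visited t) x + start        ∎
    where
    open ≡-Reasoning
    v = w (suc t)
    run′ = Run-≤ (ℕP.n≤1+n t) run
    init≡ = init-next t (run t ℕP.≤-refl)
    v∉ = next∉visited {t} run
    out = outdeg (visited t) x
    inn = indeg (visited t) x
    end = ⟦ tail (w t) ≟ₙ x ⟧
    new-end = ⟦ tail v ≟ₙ x ⟧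
    start = ⟦ x ≟ₙ 0ᵐ ⟧

  balance-at-end : ∀ t → Run t → let y = tail (w t) in
                   outdeg (visited t) y + 1 ≡ indeg (visited t) y + ⟦ y ≟ₙ 0ᵐ ⟧
  balance-at-end t run = trans
    (cong (outdeg (visited t) (tail (w t)) +_) (sym (⟦⟧-yes (tail (w t) ≟ₙ tail (w t)) refl)))
    (balance t run (tail (w t)))

  balance-inside : ∀ t → Run t → ∀ {x} → tail (w t) ≢ x → x ≢ 0ᵐ →
                   outdeg (visited t) x ≡ indeg (visited t) x
  balance-inside t run {x} end≢x x≢0 = begin
    out                       ≡⟨ ℕP.+-identityʳ out ⟨
    out + 0                   ≡⟨ cong (out +_) (⟦⟧-no (_ ≟ₙ x) end≢x) ⟨
    out + ⟦ tail (w t) ≟ₙ x ⟧  ≡⟨ balance t run x ⟩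
    inn + ⟦ x ≟ₙ 0ᵐ ⟧          ≡⟨ cong (inn +_) (⟦⟧-no (x ≟ₙ 0ᵐ) x≢0) ⟩
    inn + 0                   ≡⟨ ℕP.+-identityʳ inn ⟩
    inn                       ∎
    where
    open ≡-Reasoning
    out = outdeg (visited t) x
    inn = indeg (visited t) x

  maxL-maximal : ∀ σ → ¬ (maxL k' m F.< σ)
  maxL-maximal σ max<σ = ℕP.<⇒≱ max<σ (FP.≤fromℕ σ)

  larger-visited : ∀ t → Run t → ∀ {x σ σ′} → (x ∷ʳ σ) ∈ visited t → σ F.< σ′ →
                   (x ∷ʳ σ′) ∈ visited t
  larger-visited zero _ {x} {σ′ = σ′} (here e) σ<σ′ with VP.∷ʳ-injectiveʳ x 0ᵐ e
  ... | refl = contradiction σ<σ′ (maxL-maximal σ′)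
  larger-visited (suc t) run (there σ∈) σ<σ′ =
    there (larger-visited t (Run-≤ (ℕP.n≤1+n t) run) σ∈ σ<σ′)
  larger-visited (suc t) run {x} (here e) σ<σ′ =
    larger-than-greedy (VP.∷ʳ-injective x (tail (w t)) (trans e next≡)) σ<σ′
    where
    open GreedyStep (greedy t (run t ℕP.≤-refl))
    larger-than-greedy : ∀ {σ σ′} → x ≡ tail (w t) × σ ≡ letter → σ F.< σ′ →
                         (x ∷ʳ σ′) ∈ visited (suc t)
    larger-than-greedy (refl , refl) σ<σ′ = there (larger∈ σ<σ′)

  unvisited-below : ∀ t → Run t → ∀ {x τ σ} → (x ∷ʳ τ) ∉ visited t → (x ∷ʳ σ) ∈ visited t →
                    τ F.< σ
  unvisited-below t run {τ = τ} {σ} τ∉ σ∈ with FP.<-cmp τ σ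
  ... | tri< τ<σ _ _ = τ<σ
  ... | tri≈ _ refl _ = contradiction σ∈ τ∉
  ... | tri> _ _ σ<τ = contradiction (larger-visited t run σ∈ σ<τ) τ∉

  outdeg-≤ : ∀ t → Run t → ∀ {x τ} → (x ∷ʳ τ) ∉ visited t → outdeg (visited t) x ≤ k' ∸ toℕ τ
  outdeg-≤ t run {x} {τ} τ∉ = ℕP.≤-trans
    (count-mono (λ σ → (x ∷ʳ σ) ∈? visited t) (λ σ → suc (toℕ τ) ℕ.≤? toℕ σ)
      (λ σ → unvisited-below t run τ∉))
    (ℕP.≤-reflexive (count-≥ K (suc (toℕ τ))))

  outdeg-greedy : ∀ t → Run t → (g : GreedyStep t) →
                  outdeg (visited t) (tail (w t)) ≡ k' ∸ toℕ (GreedyStep.letter g)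
  outdeg-greedy t run g = trans
    (count-cong (λ σ → (tail (w t) ∷ʳ σ) ∈? visited t) (λ σ → suc (toℕ letter) ℕ.≤? toℕ σ)
      (λ σ → unvisited-below t run (subst (_∉ visited t) next≡ next∉)) (λ σ → larger∈))
    (count-≥ K (suc (toℕ letter)))
    where open GreedyStep g

  RaiseClosed : List W → Set
  RaiseClosed vs = ∀ {u u′} → Raise u u′ → u ∈ vs → u′ ∈ vs

  -- Otherwise y′ would have fewer visited out-edges than y but at least as many in-edges.
  raised-node-visited : ∀ t → Run t → RaiseClosed (visited t) → (g : GreedyStep t) →
                        ∀ {y′} → Raise (tail (w t)) y′ → (y′ ∷ʳ GreedyStep.letter g) ∈ visited t
  raised-node-visited t run closed g {y′} y↑y′ with (y′ ∷ʳ GreedyStep.letter g) ∈? visited t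
  ... | yes y′σ∈ = y′σ∈
  ... | no y′σ∉ = contradiction (begin-strict
      k' ∸ toℕ letter                    <⟨ ℕP.n<1+n _ ⟩
      suc (k' ∸ toℕ letter)              ≡⟨ ℕP.+-comm 1 _ ⟩
      (k' ∸ toℕ letter) + 1              ≡⟨ cong (_+ 1) (outdeg-greedy t run g) ⟨
      outdeg (visited t) y + 1           ≡⟨ balance-at-end t run ⟩
      indeg (visited t) y + ⟦ y ≟ₙ 0ᵐ ⟧  ≡⟨ cong (indeg (visited t) y +_) (⟦⟧-no (y ≟ₙ 0ᵐ) y≢0) ⟩
      indeg (visited t) y + 0            ≡⟨ ℕP.+-identityʳ _ ⟩
      indeg (visited t) y                ≤⟨ count-mono (λ b → (b ∷ y) ∈? visited t) (λ b → (b ∷ y′) ∈? visited t)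
                                              (λ b → closed (there y↑y′)) ⟩
      indeg (visited t) y′               ≡⟨ balance-inside t run (Raise-irrefl y↑y′) y′≢0 ⟨
      outdeg (visited t) y′              ≤⟨ outdeg-≤ t run y′σ∉ ⟩
      k' ∸ toℕ letter                    ∎) (ℕP.<-irrefl refl)
    where
    open ℕP.≤-Reasoning
    open GreedyStep g using (letter)
    y = tail (w t)
    y≢0 = Raise-sourceNonzero y↑y′
    y′≢0 = Raise-targetNonzero y↑y′

  raise-closed : ∀ t → Run t → RaiseClosed (visited t)
  raise-closed zero _ u↑u′ (here refl) with Raise-∷ʳ 0ᵐ (maxL k' m) u↑u′
  ... | inj₁ (_ , 0ᵐ↑y′ , _) = contradiction refl (Raise-sourceNonzero 0ᵐ↑y′)
  ... | inj₂ (σ′ , max<σ′ , _) = contradiction max<σ′ (maxL-maximal σ′)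
  raise-closed (suc t) run u↑u′ (there u∈) =
    there (raise-closed t (Run-≤ (ℕP.n≤1+n t) run) u↑u′ u∈)
  raise-closed (suc t) run u↑u′ (here refl) =
    there (raise-next (Raise-∷ʳ (tail (w t)) letter (subst (λ u → Raise u _) next≡ u↑u′)))
    where
    run′ = Run-≤ (ℕP.n≤1+n t) run
    g = greedy t (run t ℕP.≤-refl)
    open GreedyStep g
    raise-next : ∀ {u′} → (∃ λ y′ → Raise (tail (w t)) y′ × u′ ≡ y′ ∷ʳ letter)
                        ⊎ (∃ λ σ′ → letter F.< σ′ × u′ ≡ tail (w t) ∷ʳ σ′) → u′ ∈ visited t
    raise-next (inj₁ (y′ , y↑y′ , refl)) = raised-node-visited t run′ (raise-closed t run′) g y↑y′
    raise-next (inj₂ (σ′ , σ<σ′ , refl)) = larger∈ σ<σ′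

  head-below-unvisited : ∀ t → Run t → ∀ {b τ x} → w t ≡ τ ∷ x → 0 < toℕ b → b F.< τ →
                         (b ∷ x) ∉ visited t
  head-below-unvisited zero _ wt≡ _ b<τ (here e) = FP.<-irrefl (VP.∷-injectiveˡ (trans e wt≡)) b<τ
  head-below-unvisited (suc t) _ wt≡ _ b<τ (here e) = FP.<-irrefl (VP.∷-injectiveˡ (trans e wt≡)) b<τ
  head-below-unvisited (suc t) run wt≡ 0<b b<τ (there b∈) = next∉visited {t} run
    (subst (_∈ visited t) (sym wt≡) (raise-closed t (Run-≤ (ℕP.n≤1+n t) run) (here 0<b b<τ) b∈))

  indeg-at-head : ∀ t → Run t → ∀ {τ x} → w t ≡ fsuc τ ∷ x →
                  indeg (visited t) x ≡ ⟦ (fzero ∷ x) ∈? visited t ⟧ + (k' ∸ toℕ τ)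
  indeg-at-head t run {τ} {x} wt≡ = cong (⟦ (fzero ∷ x) ∈? visited t ⟧ +_) (trans
    (count-cong (λ b → (fsuc b ∷ x) ∈? visited t) (λ b → toℕ τ ℕ.≤? toℕ b)
      visited⇒above above⇒visited)
    (count-≥ k' (toℕ τ)))
    where
    w∈ : (fsuc τ ∷ x) ∈ visited t
    w∈ = subst (_∈ visited t) wt≡ (visited⁺ {t = t} ℕP.≤-refl)
    visited⇒above : ∀ b → (fsuc b ∷ x) ∈ visited t → toℕ τ ≤ toℕ b
    visited⇒above b b∈ = ℕP.≮⇒≥ λ b<τ → head-below-unvisited t run wt≡ (s≤s z≤n) (s≤s b<τ) b∈
    above⇒visited : ∀ b → toℕ τ ≤ toℕ b → (fsuc b ∷ x) ∈ visited t
    above⇒visited b τ≤b with ℕP.m≤n⇒m<n∨m≡n τ≤b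
    ... | inj₁ τ<b = raise-closed t run (here (s≤s z≤n) (s≤s τ<b)) w∈
    ... | inj₂ τ≡b = subst (λ c → (fsuc c ∷ x) ∈ visited t) (FP.toℕ-injective τ≡b) w∈

  w₀≢0ⁿ : w 0 ≢ 0ⁿ
  w₀≢0ⁿ e with VP.∷ʳ-injectiveʳ 0ᵐ 0ᵐ (trans e (replicate-∷ʳ m fzero))
  ... | ()

  zeroWord-stuck : ∀ s → Run (suc s) → w (suc s) ≡ 0ⁿ → ¬ Fresh (suc s)
  zeroWord-stuck s run ws≡0 (τ , τ∉) =
    τ∉ (subst (λ y → (y ∷ʳ τ) ∈ visited (suc s)) (sym (cong tail ws≡0)) (extension-visited τ))
    where
    open GreedyStep (greedy s (run s ℕP.≤-refl))
    split : tail (w s) ≡ 0ᵐ × letter ≡ fzero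
    split = VP.∷ʳ-injective (tail (w s)) 0ᵐ (trans (sym next≡) (trans ws≡0 (replicate-∷ʳ m fzero)))
    extension-visited : ∀ τ → (0ᵐ ∷ʳ τ) ∈ visited (suc s)
    extension-visited fzero = here (sym (trans ws≡0 (replicate-∷ʳ m fzero)))
    extension-visited (fsuc τ) = there (subst (λ y → (y ∷ʳ fsuc τ) ∈ visited s) (proj₁ split)
                                              (larger∈ (subst (F._< fsuc τ) (sym (proj₂ split)) (s≤s z≤n))))

  zeroWord-unvisited : ∀ t → Run (suc t) → 0ⁿ ∉ visited t
  zeroWord-unvisited t run 0ⁿ∈ with visited⁻ 0ⁿ∈
  ... | zero , _ , w₀≡0 = w₀≢0ⁿ w₀≡0
  ... | suc s , s<t , ws≡0 =
    zeroWord-stuck s (Run-≤ (ℕP.m≤n⇒m≤1+n s<t) run) ws≡0 (run (suc s) (s≤s s<t))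

  zeroWord-current : ∀ t → Run t → 0ⁿ ∈ visited t → w t ≡ 0ⁿ
  zeroWord-current zero _ (here e) = sym e
  zeroWord-current (suc t) _ (here e) = sym e
  zeroWord-current (suc t) run (there 0ⁿ∈) = contradiction 0ⁿ∈ (zeroWord-unvisited t run)

  walk-step-legal : ∀ t → Run (suc t) → LegalMove (last (w (suc t))) (V.head (w t))
  walk-step-legal t run =
    subst (λ σ → LegalMove σ (V.head (w t))) (sym last-next) (legal (V.head (w t)) refl)
    where
    run′ = Run-≤ (ℕP.n≤1+n t) run
    g = greedy t (run t ℕP.≤-refl)
    open GreedyStep g
    y = tail (w t)
    last-next : last (w (suc t)) ≡ letter
    last-next = trans (cong last next≡) (VP.last-∷ʳ letter y)
    σ≤k' : toℕ letter ≤ k'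
    σ≤k' = ℕP.≤-pred (FP.toℕ<n letter)
    legal-by-degrees : ∀ {τ} (d : Dec ((fzero ∷ y) ∈ visited t)) (e : Dec (y ≡ 0ᵐ)) →
                       (k' ∸ toℕ letter) + 1 ≡ (⟦ d ⟧ + (k' ∸ toℕ τ)) + ⟦ e ⟧ →
                       LegalMove letter (fsuc τ)
    legal-by-degrees (yes 0y∈) (yes y≡0) _ =
      contradiction (subst (λ z → (fzero ∷ z) ∈ visited t) y≡0 0y∈) (zeroWord-unvisited t run)
    legal-by-degrees {τ} (yes _) (no _) eq = up (cong suc (sym
      ([n∸a]+1≡[n∸b]+1⇒a≡b σ≤k' (ℕP.<⇒≤ (FP.toℕ<n τ)) (trans eq (trans (ℕP.+-identityʳ _) (ℕP.+-comm 1 _))))))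
    legal-by-degrees {τ} (no _) (yes _) eq = up (cong suc (sym
      ([n∸a]+1≡[n∸b]+1⇒a≡b σ≤k' (ℕP.<⇒≤ (FP.toℕ<n τ)) eq)))
    legal-by-degrees {τ} (no _) (no _) eq = subst (LegalMove letter)
      (FP.toℕ-injective ([n∸a]+1≡n∸b⇒a≡1+b σ≤k' (FP.toℕ<n τ) (trans eq (ℕP.+-identityʳ _)))) stay
    legal : ∀ τ → V.head (w t) ≡ τ → LegalMove letter τ
    legal fzero _ = reset
    legal (fsuc τ) head≡ = legal-by-degrees ((fzero ∷ y) ∈? visited t) (y ≟ₙ 0ᵐ) (begin
      (k' ∸ toℕ letter) + 1                                   ≡⟨ cong (_+ 1) (outdeg-greedy t run′ g) ⟨
      outdeg (visited t) y + 1                                ≡⟨ balance-at-end t run′ ⟩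
      indeg (visited t) y + y≟0                               ≡⟨ cong (_+ y≟0) (indeg-at-head t run′ wt≡) ⟩
      (⟦ (fzero ∷ y) ∈? visited t ⟧ + (k' ∸ toℕ τ)) + y≟0  ∎)
      where
      open ≡-Reasoning
      y≟0 = ⟦ y ≟ₙ 0ᵐ ⟧
      wt≡ : w t ≡ fsuc τ ∷ y
      wt≡ = trans (sym (head-∷-tail (w t))) (cong (_∷ y) head≡)

  stuck-at-zeroWord : ∀ t → Run t → ¬ Fresh t → w t ≡ 0ⁿ
  stuck-at-zeroWord t run stuck = zeroWord-current t run (zero-visited (y ≟ₙ 0ᵐ) (begin
    K + 1                              ≡⟨ cong (_+ 1) (count≡n (λ σ → (y ∷ʳ σ) ∈? visited t) extensions) ⟨
    outdeg (visited t) y + 1           ≡⟨ balance-at-end t run ⟩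
    indeg (visited t) y + ⟦ y ≟ₙ 0ᵐ ⟧  ∎))
    where
    open ≡-Reasoning
    y = tail (w t)
    extensions : ∀ σ → (y ∷ʳ σ) ∈ visited t
    extensions σ = decidable-stable ((y ∷ʳ σ) ∈? visited t) (λ σ∉ → stuck (σ , σ∉))
    zero-visited : (d : Dec (y ≡ 0ᵐ)) → K + 1 ≡ indeg (visited t) y + ⟦ d ⟧ → 0ⁿ ∈ visited t
    zero-visited (no _) eq = contradiction (count≤n (λ b → (b ∷ y) ∈? visited t))
      (ℕP.<⇒≱ (ℕP.≤-reflexive (trans (ℕP.+-comm 1 K) (trans eq (ℕP.+-identityʳ _)))))
    zero-visited (yes y≡0) eq = subst (λ z → (fzero ∷ z) ∈ visited t) y≡0
      (count≡n⇒all (λ b → (b ∷ y) ∈? visited t) (ℕP.+-cancelʳ-≡ 1 _ _ (sym eq)) fzero)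

  balanced-at-zeroWord : ∀ t → Run t → w t ≡ 0ⁿ → ∀ x →
                         outdeg (visited t) x ≡ indeg (visited t) x
  balanced-at-zeroWord t run wt≡0 x = ℕP.+-cancelʳ-≡ ⟦ x ≟ₙ 0ᵐ ⟧ _ _ (trans
    (cong (outdeg (visited t) x +_)
      (⟦⟧-cong (x ≟ₙ 0ᵐ) (tail (w t) ≟ₙ x)
        (λ e → trans end≡0 (sym e)) (λ e → trans (sym e) end≡0)))
    (balance t run x))
    where
    end≡0 : tail (w t) ≡ 0ᵐ
    end≡0 = cong tail wt≡0

  -- With indeg = outdeg everywhere, a visited word (tail u)0 forces u itself to be visited;
  -- shifting zeros into u leads to the visited word 0ⁿ.
  stuck-visited-all : ∀ t → Run t → ¬ Fresh t → ∀ u → u ∈ visited t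
  stuck-visited-all t run stuck u =
    unshift (suc m) u (subst (_∈ visited t) (sym (iterate-shiftIn-replicate m fzero u)) 0ⁿ∈)
    where
    wt≡0 = stuck-at-zeroWord t run stuck
    0ⁿ∈ : 0ⁿ ∈ visited t
    0ⁿ∈ = subst (_∈ visited t) wt≡0 (visited⁺ {t = t} ℕP.≤-refl)
    unshift₁ : ∀ u → shiftIn fzero u ∈ visited t → u ∈ visited t
    unshift₁ u 0∈ = subst (_∈ visited t) (head-∷-tail u)
      (count≡n⇒all (λ b → (b ∷ tail u) ∈? visited t) indeg≡K (V.head u))
      where
      extensions : ∀ σ → (tail u ∷ʳ σ) ∈ visited t
      extensions fzero = 0∈
      extensions (fsuc σ) = larger-visited t run 0∈ (s≤s z≤n)
      indeg≡K : indeg (visited t) (tail u) ≡ K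
      indeg≡K = trans (sym (balanced-at-zeroWord t run wt≡0 (tail u)))
                      (count≡n (λ σ → (tail u ∷ʳ σ) ∈? visited t) extensions)
    unshift : ∀ d u → iterate (shiftIn fzero) u d ∈ visited t → u ∈ visited t
    unshift zero u u∈ = u∈
    unshift (suc d) u u∈ = unshift₁ u (unshift d (shiftIn fzero u) u∈)

  run-length : ∀ t → Run t → suc t ≤ N
  run-length t run = injection-into-words (λ (i : Fin (suc t)) → w (toℕ i)) w-inj
    where
    w-inj : Injective _≡_ _≡_ (λ (i : Fin (suc t)) → w (toℕ i))
    w-inj {i} {i′} e with FP.<-cmp i i′
    ... | tri< i<i′ _ _ = contradiction e (w-injective t run i<i′ (ℕP.≤-pred (FP.toℕ<n i′)))
    ... | tri≈ _ i≡i′ _ = i≡i′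
    ... | tri> _ _ i′<i = contradiction (sym e) (w-injective t run i′<i (ℕP.≤-pred (FP.toℕ<n i)))

  visited-all-length : ∀ t → (∀ u → u ∈ visited t) → N ≤ suc t
  visited-all-length t all = surjection-onto-words (λ (i : Fin (suc t)) → w (toℕ i)) onto
    where
    onto : ∀ u → ∃ λ (i : Fin (suc t)) → w (toℕ i) ≡ u
    onto u with visited⁻ (all u)
    ... | s , s≤t , ws≡u = F.fromℕ< (s≤s s≤t) , trans (cong w (FP.toℕ-fromℕ< (s≤s s≤t))) ws≡u

  preferMax-complete : ∃ λ ℓ → suc ℓ ≡ N × Run ℓ × w ℓ ≡ 0ⁿ
  preferMax-complete with all-below-or-first-failure fresh? N
  ... | inj₁ run = contradiction (run-length N run) (ℕP.<-irrefl refl)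
  ... | inj₂ (ℓ , ℓ<N , run , stuck) =
    ℓ , ℕP.≤-antisym ℓ<N (visited-all-length ℓ (stuck-visited-all ℓ run stuck)) ,
    run , stuck-at-zeroWord ℓ run stuck

  indexFrom-first : ∀ i r d {u} → d < r → w (i + d) ≡ u → (∀ e → e < d → w (i + e) ≢ u) →
                    indexFrom k' m i r u ≡ i + d
  indexFrom-first i (suc r) zero {u} _ wi≡u _ with _≟W_ k' m (preferMax k' m i) u
  ... | yes _ = sym (ℕP.+-identityʳ i)
  ... | no wi≢u = contradiction (trans (cong w (sym (ℕP.+-identityʳ i))) wi≡u) wi≢u
  indexFrom-first i (suc r) (suc d) {u} d<r wd≡u earlier with _≟W_ k' m (preferMax k' m i) u
  ... | yes wi≡u = contradiction (trans (cong w (ℕP.+-identityʳ i)) wi≡u) (earlier 0 (s≤s z≤n))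
  ... | no _ = trans
    (indexFrom-first (suc i) r d (ℕP.≤-pred d<r) (trans (cong w (sym (ℕP.+-suc i d))) wd≡u)
      λ e e<d → subst (λ z → w z ≢ u) (ℕP.+-suc i e) (earlier (suc e) (s≤s e<d)))
    (sym (ℕP.+-suc i d))

  module _ {ℓ} (ℓ+1≡N : suc ℓ ≡ N) (run : Run ℓ) where

    index-w : s ≤ ℓ → index k' m (w s) ≡ s
    index-w {s} s≤ℓ =
      indexFrom-first 0 N s (subst (s <_) ℓ+1≡N (s≤s s≤ℓ)) refl λ e e<s → w-injective ℓ run e<s s≤ℓ

    predW-next : s < ℓ → predW k' m (w (suc s)) ≡ w s
    predW-next s<ℓ rewrite index-w s<ℓ = refl

    move-back : s < ℓ → move (w (suc s)) ≡ w s
    move-back {s} s<ℓ = begin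
      move (w (suc s))                 ≡⟨ gameStep-reverses (w (suc s)) pred≡ (walk-step-legal s (Run-≤ s<ℓ run)) ⟩
      V.head (w s) ∷ init (w (suc s))  ≡⟨ cong (V.head (w s) ∷_) init≡ ⟩
      V.head (w s) ∷ tail (w s)        ≡⟨ head-∷-tail (w s) ⟩
      w s                              ∎
      where
      open ≡-Reasoning
      open Strategies k' m using (gameStep-reverses)
      init≡ : init (w (suc s)) ≡ tail (w s)
      init≡ = init-next s (run s s<ℓ)
      pred≡ : predW k' m (w (suc s)) ≡ V.head (w s) ∷ init (w (suc s))
      pred≡ = trans (predW-next s<ℓ)
                    (trans (sym (head-∷-tail (w s))) (cong (V.head (w s) ∷_) (sym init≡)))

    play-reversed : w ℓ ≡ 0ⁿ → ∀ t s → t + s ≡ ℓ → position t ≡ w s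
    play-reversed wℓ≡0 zero s refl = sym wℓ≡0
    play-reversed wℓ≡0 (suc t) s t+s≡ℓ = begin
      move (position t)  ≡⟨ cong move (play-reversed wℓ≡0 t (suc s) t+1+s≡ℓ) ⟩
      move (w (suc s))   ≡⟨ move-back (subst (suc s ≤_) t+1+s≡ℓ (ℕP.m≤n+m (suc s) t)) ⟩
      w s                ∎
      where
      open ≡-Reasoning
      t+1+s≡ℓ : t + suc s ≡ ℓ
      t+1+s≡ℓ = trans (ℕP.+-suc t s) t+s≡ℓ

proposition15 : (m j : ℕ) → (t : ℕ) → t < suc (suc j) ^ suc m →
    play (suc j) m (Bstar (suc j) m) (Astar (suc j) m) t
      ≡ preferMax (suc j) m (suc (suc j) ^ suc m ∸ 1 ∸ t)
proposition15 m j t t<N with PreferMaxCycle.preferMax-complete j m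
... | ℓ , ℓ+1≡N , run , wℓ≡0ⁿ =
  subst (λ ℓ′ → play (suc j) m (Bstar (suc j) m) (Astar (suc j) m) t ≡ preferMax (suc j) m (ℓ′ ∸ t))
        (cong (_∸ 1) ℓ+1≡N)
        (PreferMaxCycle.play-reversed j m ℓ+1≡N run wℓ≡0ⁿ t (ℓ ∸ t) (ℕP.m+[n∸m]≡n t≤ℓ))
  where
  t≤ℓ : t ≤ ℓ
  t≤ℓ = ℕP.≤-pred (subst (t <_) (sym ℓ+1≡N) t<N)
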